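{- For any $\lambda^{\Box\rightarrow\wedge\vee}$-terms $t,s$, if $t>_P s$ then $|t|>|s|$.
   Context: Terms of $\lambda^{\Box\rightarrow\wedge\vee}$: $x\mid \lambda x.t\mid ts\mid \langle t,s\rangle\mid \pi_1 t\mid \pi_2 t\mid \mathsf{in}_1 t\mid \mathsf{in}_2 t\mid \mathsf{C}_{x,y}(t,t_1,t_2)\mid \mathsf{B}_{x_1,\dots,x_n}(t_1,\dots,t_n)\,\mathsf{in}\,s$. Permutations $>_P$ (closed under term contexts): $\mathsf{C}_{x,y}(t,t_1,t_2)s>\mathsf{C}_{x,y}(t,t_1s,t_2s)$; $\pi_i\mathsf{C}_{x,y}(t,t_1,t_2)>\mathsf{C}_{x,y}(t,\pi_it_1,\pi_it_2)$; $\mathsf{C}_{u,v}(\mathsf{C}_{x,y}(t,t_1,t_2),s_1,s_2)>\mathsf{C}_{x,y}(t,\mathsf{C}_{u,v}(t_1,s_1,s_2),\mathsf{C}_{u,v}(t_2,s_1,s_2))$; $\mathsf{B}_{\vec x}(t_1,\dots,t_{i-1},\mathsf{C}_{x,y}(t,s_1,s_2),t_{i+1},\dots,t_n)\,\mathsf{in}\,s>\mathsf{C}_{x,y}(t,\mathsf{B}_{\vec x}(t_1,\dots,s_1,\dots,t_n)\,\mathsf{in}\,s,\ \mathsf{B}_{\vec x}(t_1,\dots,s_2,\dots,t_n)\,\mathsf{in}\,s)$. Auxiliary $\#$: $\#x=1$; $\#\lambda x.t=1$; $\#(ts)=\#t$; $\#\langle t,s\rangle=1$; $\#\pi_it=\#t$;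 $\#\mathsf{in}_it=1$; $\#\mathsf{C}_{x,y}(t,t_1,t_2)=2\cdot\#t\cdot(\#t_1+\#t_2)$; $\#(\mathsf{B}_{\vec x}(t_1,\dots,t_n)\,\mathsf{in}\,s)=\#s\cdot\prod_{i=1}^n\#t_i$. Norm $|\cdot|$: $|x|=1$; $|\lambda x.t|=|t|$; $|ts|=|t|+\#t\cdot|s|$; $|\langle t,s\rangle|=|t|+|s|$; $|\pi_it|=|t|+\#t$; $|\mathsf{in}_it|=|t|$; $|\mathsf{C}_{x,y}(t,t_1,t_2)|=|t|+\#t\cdot(|t_1|+|t_2|)$; $|\mathsf{B}_{x_1,\dots,x_n}(t_1,\dots,t_n)\,\mathsf{in}\,s|=|s|\cdot\prod_{i=1}^n|t_i|+\prod_{i=1}^n\#t_i$. -}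

module Defs where

open import Data.Nat using (ℕ; _+_; _*_; _<_)
open import Data.Fin using (Fin)
open import Data.Vec using (Vec; []; _∷_; lookup; _[_]≔_)

Var : Set
Var = ℕ

data Term : Set where
  var  : Var → Term
  lam  : Var → Term → Term
  app  : Term → Term → Term
  pair : Term → Term → Term
  π₁ π₂ : Term → Term
  in₁ in₂ : Term → Term
  case : Var → Var → Term → Term → Term → Term
  -- B_{x₁..xₙ}(t₁,…,tₙ) in s
  box  : {n : ℕ} → Vec Var n → Vec Term n → Term → Term

mutual
  hash : Term → ℕ
  hash (var x) = 1
  hash (lam x t) = 1
  hash (app t s) = hash t
  hash (pair t s) = 1
  hash (π₁ t) = hash t
  hash (π₂ t) = hash t
  hash (in₁ t) = 1
  hash (in₂ t) = 1
  hash (case x y t t₁ t₂) = 2 * hash t * (hash t₁ + hash t₂)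
  hash (box xs ts s) = hash s * hashProd ts

  hashProd : {n : ℕ} → Vec Term n → ℕ
  hashProd [] = 1
  hashProd (t ∷ ts) = hash t * hashProd ts

mutual
  norm : Term → ℕ
  norm (var x) = 1
  norm (lam x t) = norm t
  norm (app t s) = norm t + hash t * norm s
  norm (pair t s) = norm t + norm s
  norm (π₁ t) = norm t + hash t
  norm (π₂ t) = norm t + hash t
  norm (in₁ t) = norm t
  norm (in₂ t) = norm t
  norm (case x y t t₁ t₂) = norm t + hash t * (norm t₁ + norm t₂)
  norm (box xs ts s) = norm s * normProd ts + hashProd ts

  normProd : {n : ℕ} → Vec Term n → ℕ
  normProd [] = 1
  normProd (t ∷ ts) = norm t * normProd ts

data _>P₀_ : Term → Term → Set where
  p-app  : ∀ {x y t t₁ t₂ s} →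
           app (case x y t t₁ t₂) s >P₀ case x y t (app t₁ s) (app t₂ s)
  p-π₁   : ∀ {x y t t₁ t₂} →
           π₁ (case x y t t₁ t₂) >P₀ case x y t (π₁ t₁) (π₁ t₂)
  p-π₂   : ∀ {x y t t₁ t₂} →
           π₂ (case x y t t₁ t₂) >P₀ case x y t (π₂ t₁) (π₂ t₂)
  p-case : ∀ {u v x y t t₁ t₂ s₁ s₂} →
           case u v (case x y t t₁ t₂) s₁ s₂
             >P₀ case x y t (case u v t₁ s₁ s₂) (case u v t₂ s₁ s₂)
  p-box  : ∀ {n} {xs : Vec Var n} {ts : Vec Term n} (i : Fin n) {x y t s₁ s₂ s} →
           box xs (ts [ i ]≔ case x y t s₁ s₂) s
             >P₀ case x y t (box xs (ts [ i ]≔ s₁) s) (box xs (ts [ i ]≔ s₂) s)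

data _>P_ : Term → Term → Set where
  root   : ∀ {t s} → t >P₀ s → t >P s
  c-lam  : ∀ {x t t'} → t >P t' → lam x t >P lam x t'
  c-appˡ : ∀ {t t' s} → t >P t' → app t s >P app t' s
  c-appʳ : ∀ {t s s'} → s >P s' → app t s >P app t s'
  c-pairˡ : ∀ {t t' s} → t >P t' → pair t s >P pair t' s
  c-pairʳ : ∀ {t s s'} → s >P s' → pair t s >P pair t s'
  c-π₁   : ∀ {t t'} → t >P t' → π₁ t >P π₁ t'
  c-π₂   : ∀ {t t'} → t >P t' → π₂ t >P π₂ t'
  c-in₁  : ∀ {t t'} → t >P t' → in₁ t >P in₁ t'
  c-in₂  : ∀ {t t'} → t >P t' → in₂ t >P in₂ t'
  c-case₀ : ∀ {x y t t' t₁ t₂} → t >P t' → case x y t t₁ t₂ >P case x y t' t₁ t₂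
  c-case₁ : ∀ {x y t t₁ t₁' t₂} → t₁ >P t₁' → case x y t t₁ t₂ >P case x y t t₁' t₂
  c-case₂ : ∀ {x y t t₁ t₂ t₂'} → t₂ >P t₂' → case x y t t₁ t₂ >P case x y t t₁ t₂'
  c-boxᵢ : ∀ {n} {xs : Vec Var n} {ts : Vec Term n} {s t'} (i : Fin n) →
           lookup ts i >P t' → box xs ts s >P box xs (ts [ i ]≔ t') s
  c-boxₛ : ∀ {n} {xs : Vec Var n} {ts : Vec Term n} {s s'} →
           s >P s' → box xs ts s >P box xs ts s'

{-# OPTIONS --safe #-}
-- The
-- measure # is invariant under every step, and at the root the norm drops by
-- at least #t·(#t₁ + #t₂)·w > 0, where w is the weight the moved C carried:
-- the norm of the argument, 1 under a projection, the norms of the two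
-- branches of an outer C, or the #-product of the other components of a B.  Under contexts, | · | is strictly monotone in each
-- argument once the #-coefficients are known to be positive and invariant.
module Submission where

open import Defs
open import Data.Nat using (ℕ; suc; _+_; _*_; _≤_; _<_; z≤n; s≤s)
open import Data.Nat.Base using (>-nonZero)
open import Data.Nat.Properties
open import Data.Fin using (zero; suc)
open import Data.Vec using (Vec; []; _∷_; lookup; _[_]≔_; removeAt)
open import Data.Vec.Properties using ([]≔-lookup)
open import Relation.Binary.PropositionalEquality
open import Data.Nat.Solver using (module +-*-Solver)
open +-*-Solver

*-positive : ∀ {m n} → 0 < m → 0 < n → 0 < m * n
*-positive {suc m} {suc n} _ _ = s≤s z≤n

+-positive : ∀ {m} n → 0 < m → 0 < m + n
+-positive {m} n m>0 = ≤-trans m>0 (m≤m+n m n)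

*-monoʳ-<-positive : ∀ {c a b} → 0 < c → a < b → c * a < c * b
*-monoʳ-<-positive {c} c>0 = *-monoʳ-< c {{>-nonZero c>0}}

*-monoˡ-<-positive : ∀ {c a b} → 0 < c → a < b → a * c < b * c
*-monoˡ-<-positive {c} c>0 = *-monoˡ-< c {{>-nonZero c>0}}

module _ {A : Set} (f : A → ℕ) where

  ∏ : ∀ {n} → Vec A n → ℕ
  ∏ []       = 1
  ∏ (x ∷ xs) = f x * ∏ xs

  ∏-positive : (∀ x → 0 < f x) → ∀ {n} (xs : Vec A n) → 0 < ∏ xs
  ∏-positive f>0 []       = s≤s z≤n
  ∏-positive f>0 (x ∷ xs) = *-positive (f>0 x) (∏-positive f>0 xs)

  ∏-[]≔ : ∀ {n} (xs : Vec A (suc n)) i y → ∏ (xs [ i ]≔ y) ≡ f y * ∏ (removeAt xs i)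
  ∏-[]≔ (x ∷ xs)           zero    y = refl
  ∏-[]≔ (x ∷ xs@(_ ∷ _)) (suc i) y = begin
    f x * ∏ (xs [ i ]≔ y)             ≡⟨ cong (f x *_) (∏-[]≔ xs i y) ⟩
    f x * (f y * ∏ (removeAt xs i))   ≡⟨ solve 3 (λ a b c → a :* (b :* c) := b :* (a :* c))
                                                 refl (f x) (f y) (∏ (removeAt xs i)) ⟩
    f y * (f x * ∏ (removeAt xs i))   ∎
    where open ≡-Reasoning

  ∏-lookup : ∀ {n} (xs : Vec A (suc n)) i → ∏ xs ≡ f (lookup xs i) * ∏ (removeAt xs i)
  ∏-lookup xs i = trans (cong ∏ (sym ([]≔-lookup xs i))) (∏-[]≔ xs i (lookup xs i))

  ∏-[]≔-cong : ∀ {n} (xs : Vec A n) i {y} → f y ≡ f (lookup xs i) → ∏ (xs [ i ]≔ y) ≡ ∏ xs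
  ∏-[]≔-cong xs@(_ ∷ _) i {y} eq = begin
    ∏ (xs [ i ]≔ y)                         ≡⟨ ∏-[]≔ xs i y ⟩
    f y * ∏ (removeAt xs i)                 ≡⟨ cong (_* ∏ (removeAt xs i)) eq ⟩
    f (lookup xs i) * ∏ (removeAt xs i)     ≡⟨ sym (∏-lookup xs i) ⟩
    ∏ xs                                    ∎
    where open ≡-Reasoning

  ∏-[]≔-< : (∀ x → 0 < f x) → ∀ {n} (xs : Vec A n) i {y} →
            f y < f (lookup xs i) → ∏ (xs [ i ]≔ y) < ∏ xs
  ∏-[]≔-< f>0 xs@(_ ∷ _) i {y} lt = begin-strict
    ∏ (xs [ i ]≔ y)                         ≡⟨ ∏-[]≔ xs i y ⟩
    f y * ∏ (removeAt xs i)                 <⟨ *-monoˡ-<-positive (∏-positive f>0 (removeAt xs i)) lt ⟩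
    f (lookup xs i) * ∏ (removeAt xs i)     ≡⟨ sym (∏-lookup xs i) ⟩
    ∏ xs                                    ∎
    where open ≤-Reasoning

hashProd≡∏ : ∀ {n} (ts : Vec Term n) → hashProd ts ≡ ∏ hash ts
hashProd≡∏ []       = refl
hashProd≡∏ (t ∷ ts) = cong (hash t *_) (hashProd≡∏ ts)

normProd≡∏ : ∀ {n} (ts : Vec Term n) → normProd ts ≡ ∏ norm ts
normProd≡∏ []       = refl
normProd≡∏ (t ∷ ts) = cong (norm t *_) (normProd≡∏ ts)

mutual
  hash-positive : ∀ t → 0 < hash t
  hash-positive (var x)            = s≤s z≤n
  hash-positive (lam x t)          = s≤s z≤n
  hash-positive (app t s)          = hash-positive t
  hash-positive (pair t s)         = s≤s z≤n
  hash-positive (π₁ t)             = hash-positive t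
  hash-positive (π₂ t)             = hash-positive t
  hash-positive (in₁ t)            = s≤s z≤n
  hash-positive (in₂ t)            = s≤s z≤n
  hash-positive (case x y t t₁ t₂) =
    *-positive (*-positive {2} (s≤s z≤n) (hash-positive t)) (+-positive _ (hash-positive t₁))
  hash-positive (box xs ts s)      = *-positive (hash-positive s) (hashProd-positive ts)

  hashProd-positive : ∀ {n} (ts : Vec Term n) → 0 < hashProd ts
  hashProd-positive []       = s≤s z≤n
  hashProd-positive (t ∷ ts) = *-positive (hash-positive t) (hashProd-positive ts)

mutual
  norm-positive : ∀ t → 0 < norm t
  norm-positive (var x)            = s≤s z≤n
  norm-positive (lam x t)          = norm-positive t
  norm-positive (app t s)          = +-positive _ (norm-positive t)
  norm-positive (pair t s)         = +-positive _ (norm-positive t)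
  norm-positive (π₁ t)             = +-positive _ (norm-positive t)
  norm-positive (π₂ t)             = +-positive _ (norm-positive t)
  norm-positive (in₁ t)            = norm-positive t
  norm-positive (in₂ t)            = norm-positive t
  norm-positive (case x y t t₁ t₂) = +-positive _ (norm-positive t)
  norm-positive (box xs ts s)      = +-positive _ (*-positive (norm-positive s) (normProd-positive ts))

  normProd-positive : ∀ {n} (ts : Vec Term n) → 0 < normProd ts
  normProd-positive []       = s≤s z≤n
  normProd-positive (t ∷ ts) = *-positive (norm-positive t) (normProd-positive ts)

hashProd-[]≔ : ∀ {n} (ts : Vec Term (suc n)) i u →
               hashProd (ts [ i ]≔ u) ≡ hash u * ∏ hash (removeAt ts i)
hashProd-[]≔ ts i u = trans (hashProd≡∏ (ts [ i ]≔ u)) (∏-[]≔ hash ts i u)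

normProd-[]≔ : ∀ {n} (ts : Vec Term (suc n)) i u →
               normProd (ts [ i ]≔ u) ≡ norm u * ∏ norm (removeAt ts i)
normProd-[]≔ ts i u = trans (normProd≡∏ (ts [ i ]≔ u)) (∏-[]≔ norm ts i u)

hashProd-[]≔-cong : ∀ {n} (ts : Vec Term n) i {u} →
                    hash u ≡ hash (lookup ts i) → hashProd (ts [ i ]≔ u) ≡ hashProd ts
hashProd-[]≔-cong ts i {u} eq = begin
  hashProd (ts [ i ]≔ u)  ≡⟨ hashProd≡∏ (ts [ i ]≔ u) ⟩
  ∏ hash (ts [ i ]≔ u)    ≡⟨ ∏-[]≔-cong hash ts i eq ⟩
  ∏ hash ts               ≡⟨ sym (hashProd≡∏ ts) ⟩
  hashProd ts             ∎
  where open ≡-Reasoning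

normProd-[]≔-< : ∀ {n} (ts : Vec Term n) i {u} →
                 norm u < norm (lookup ts i) → normProd (ts [ i ]≔ u) < normProd ts
normProd-[]≔-< ts i {u} lt = begin-strict
  normProd (ts [ i ]≔ u)  ≡⟨ normProd≡∏ (ts [ i ]≔ u) ⟩
  ∏ norm (ts [ i ]≔ u)    <⟨ ∏-[]≔-< norm norm-positive ts i lt ⟩
  ∏ norm ts               ≡⟨ sym (normProd≡∏ ts) ⟩
  normProd ts             ∎
  where open ≤-Reasoning

hash-invariant : ∀ {t s} → t >P s → hash s ≡ hash t
hash-invariant (root p-app)  = refl
hash-invariant (root p-π₁)   = refl
hash-invariant (root p-π₂)   = refl
hash-invariant (root (p-case {t = t} {t₁} {t₂} {s₁} {s₂})) =
  solve 5 (λ a b c d e → con 2 :* a :* (con 2 :* b :* (d :+ e) :+ con 2 :* c :* (d :+ e))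
                       := con 2 :* (con 2 :* a :* (b :+ c)) :* (d :+ e))
    refl (hash t) (hash t₁) (hash t₂) (hash s₁) (hash s₂)
hash-invariant (root (p-box {ts = ts@(_ ∷ _)} i {t = t} {s₁} {s₂} {s})) =
  begin
    2 * hash t * (hash s * hashProd (ts [ i ]≔ s₁) + hash s * hashProd (ts [ i ]≔ s₂))
  ≡⟨ cong₂ (λ p q → 2 * hash t * (hash s * p + hash s * q)) (hashProd-[]≔ ts i s₁) (hashProd-[]≔ ts i s₂) ⟩
    2 * hash t * (hash s * (hash s₁ * R) + hash s * (hash s₂ * R))
  ≡⟨ solve 5 (λ a b c d r → con 2 :* a :* (d :* (b :* r) :+ d :* (c :* r))
                         := d :* ((con 2 :* a :* (b :+ c)) :* r))
       refl (hash t) (hash s₁) (hash s₂) (hash s) R ⟩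
    hash s * ((2 * hash t * (hash s₁ + hash s₂)) * R)
  ≡⟨ cong (hash s *_) (sym (hashProd-[]≔ ts i _)) ⟩
    hash s * hashProd (ts [ i ]≔ _)
  ∎
  where
  open ≡-Reasoning
  R = ∏ hash (removeAt ts i)
hash-invariant (c-lam p)   = refl
hash-invariant (c-appˡ p)  = hash-invariant p
hash-invariant (c-appʳ p)  = refl
hash-invariant (c-pairˡ p) = refl
hash-invariant (c-pairʳ p) = refl
hash-invariant (c-π₁ p)    = hash-invariant p
hash-invariant (c-π₂ p)    = hash-invariant p
hash-invariant (c-in₁ p)   = refl
hash-invariant (c-in₂ p)   = refl
hash-invariant (c-case₀ p) = cong (λ h → 2 * h * _) (hash-invariant p)
hash-invariant (c-case₁ {t = t} {t₂ = t₂} p) = cong (λ h → 2 * hash t * (h + hash t₂)) (hash-invariant p)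
hash-invariant (c-case₂ {t = t} {t₁ = t₁} p) = cong (λ h → 2 * hash t * (hash t₁ + h)) (hash-invariant p)
hash-invariant (c-boxᵢ {ts = ts} {s = s} i p) = cong (hash s *_) (hashProd-[]≔-cong ts i (hash-invariant p))
hash-invariant (c-boxₛ p)  = cong (_* _) (hash-invariant p)

case-pushed-< : ∀ N H a₁ a₂ h₁ h₂ w → 0 < H → 0 < h₁ → 0 < w →
                N + H * ((a₁ + h₁ * w) + (a₂ + h₂ * w)) < N + H * (a₁ + a₂) + 2 * H * (h₁ + h₂) * w
case-pushed-< N H a₁ a₂ h₁ h₂ w H>0 h₁>0 w>0 = begin-strict
  N + H * ((a₁ + h₁ * w) + (a₂ + h₂ * w))
    <⟨ m<m+n _ (*-positive (*-positive H>0 (+-positive h₂ h₁>0)) w>0) ⟩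
  N + H * ((a₁ + h₁ * w) + (a₂ + h₂ * w)) + H * (h₁ + h₂) * w
    ≡⟨ solve 7 (λ N H a₁ a₂ h₁ h₂ w →
         N :+ H :* ((a₁ :+ h₁ :* w) :+ (a₂ :+ h₂ :* w)) :+ H :* (h₁ :+ h₂) :* w
         := N :+ H :* (a₁ :+ a₂) :+ con 2 :* H :* (h₁ :+ h₂) :* w)
       refl N H a₁ a₂ h₁ h₂ w ⟩
  N + H * (a₁ + a₂) + 2 * H * (h₁ + h₂) * w ∎
  where open ≤-Reasoning

case-pushed-<₁ : ∀ N H a₁ a₂ h₁ h₂ → 0 < H → 0 < h₁ →
                 N + H * ((a₁ + h₁) + (a₂ + h₂)) < N + H * (a₁ + a₂) + 2 * H * (h₁ + h₂)
case-pushed-<₁ N H a₁ a₂ h₁ h₂ H>0 h₁>0 =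
  subst₂ _<_ (cong₂ (λ b₁ b₂ → N + H * ((a₁ + b₁) + (a₂ + b₂))) (*-identityʳ h₁) (*-identityʳ h₂))
             (cong (N + H * (a₁ + a₂) +_) (*-identityʳ (2 * H * (h₁ + h₂))))
             (case-pushed-< N H a₁ a₂ h₁ h₂ 1 H>0 h₁>0 (s≤s z≤n))

box-scaled-≤ : ∀ N H a₁ a₂ c r → 0 < c * r →
               N + H * (c * (a₁ * r) + c * (a₂ * r)) ≤ c * ((N + H * (a₁ + a₂)) * r)
box-scaled-≤ N H a₁ a₂ c r cr>0 = begin
  N + H * (c * (a₁ * r) + c * (a₂ * r))
    ≤⟨ +-monoˡ-≤ _ (m≤n*m N (c * r) {{>-nonZero cr>0}}) ⟩
  c * r * N + H * (c * (a₁ * r) + c * (a₂ * r))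
    ≡⟨ solve 6 (λ N H a₁ a₂ c r →
         c :* r :* N :+ H :* (c :* (a₁ :* r) :+ c :* (a₂ :* r)) := c :* ((N :+ H :* (a₁ :+ a₂)) :* r))
       refl N H a₁ a₂ c r ⟩
  c * ((N + H * (a₁ + a₂)) * r) ∎
  where open ≤-Reasoning

norm-<-root : ∀ {t s} → t >P₀ s → norm s < norm t
norm-<-root (p-app {t = t} {t₁} {t₂} {s}) =
  case-pushed-< (norm t) (hash t) (norm t₁) (norm t₂) (hash t₁) (hash t₂) (norm s)
    (hash-positive t) (hash-positive t₁) (norm-positive s)
norm-<-root (p-π₁ {t = t} {t₁} {t₂}) =
  case-pushed-<₁ (norm t) (hash t) (norm t₁) (norm t₂) (hash t₁) (hash t₂)
    (hash-positive t) (hash-positive t₁)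
norm-<-root (p-π₂ {t = t} {t₁} {t₂}) =
  case-pushed-<₁ (norm t) (hash t) (norm t₁) (norm t₂) (hash t₁) (hash t₂)
    (hash-positive t) (hash-positive t₁)
norm-<-root (p-case {t = t} {t₁} {t₂} {s₁} {s₂}) =
  case-pushed-< (norm t) (hash t) (norm t₁) (norm t₂) (hash t₁) (hash t₂) (norm s₁ + norm s₂)
    (hash-positive t) (hash-positive t₁) (+-positive _ (norm-positive s₁))
norm-<-root (p-box {ts = ts@(_ ∷ _)} i {x = x} {y} {t} {s₁} {s₂} {s}) = begin-strict
  N + H * ((ns * normProd (ts [ i ]≔ s₁) + hashProd (ts [ i ]≔ s₁))
         + (ns * normProd (ts [ i ]≔ s₂) + hashProd (ts [ i ]≔ s₂)))
    ≡⟨ cong₂ (λ b₁ b₂ → N + H * (b₁ + b₂)) (box-norm s₁) (box-norm s₂) ⟩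
  N + H * ((ns * (n₁ * R) + h₁ * Rₕ) + (ns * (n₂ * R) + h₂ * Rₕ))
    <⟨ case-pushed-< N H (ns * (n₁ * R)) (ns * (n₂ * R)) h₁ h₂ Rₕ
         (hash-positive t) (hash-positive s₁) (∏-positive hash hash-positive (removeAt ts i)) ⟩
  N + H * (ns * (n₁ * R) + ns * (n₂ * R)) + 2 * H * (h₁ + h₂) * Rₕ
    ≤⟨ +-monoˡ-≤ _ (box-scaled-≤ N H n₁ n₂ ns R
         (*-positive (norm-positive s) (∏-positive norm norm-positive (removeAt ts i)))) ⟩
  ns * ((N + H * (n₁ + n₂)) * R) + 2 * H * (h₁ + h₂) * Rₕ
    ≡⟨ sym (box-norm (case x y t s₁ s₂)) ⟩
  ns * normProd (ts [ i ]≔ case x y t s₁ s₂) + hashProd (ts [ i ]≔ case x y t s₁ s₂) ∎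
  where
  open ≤-Reasoning
  N = norm t
  H = hash t
  n₁ = norm s₁
  n₂ = norm s₂
  h₁ = hash s₁
  h₂ = hash s₂
  ns = norm s
  R = ∏ norm (removeAt ts i)
  Rₕ = ∏ hash (removeAt ts i)
  box-norm : ∀ u → ns * normProd (ts [ i ]≔ u) + hashProd (ts [ i ]≔ u)
                 ≡ ns * (norm u * R) + hash u * Rₕ
  box-norm u = cong₂ (λ a b → ns * a + b) (normProd-[]≔ ts i u) (hashProd-[]≔ ts i u)

lemma7 : ∀ {t s : Term} → t >P s → norm s < norm t
lemma7 (root p)    = norm-<-root p
lemma7 (c-lam p)   = lemma7 p
lemma7 (c-appˡ p) rewrite hash-invariant p = +-monoˡ-< _ (lemma7 p)
lemma7 (c-appʳ {t = t} p) = +-monoʳ-< (norm t) (*-monoʳ-<-positive (hash-positive t) (lemma7 p))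
lemma7 (c-pairˡ p) = +-monoˡ-< _ (lemma7 p)
lemma7 (c-pairʳ {t = t} p) = +-monoʳ-< (norm t) (lemma7 p)
lemma7 (c-π₁ p) rewrite hash-invariant p = +-monoˡ-< _ (lemma7 p)
lemma7 (c-π₂ p) rewrite hash-invariant p = +-monoˡ-< _ (lemma7 p)
lemma7 (c-in₁ p)   = lemma7 p
lemma7 (c-in₂ p)   = lemma7 p
lemma7 (c-case₀ p) rewrite hash-invariant p = +-monoˡ-< _ (lemma7 p)
lemma7 (c-case₁ {t = t} {t₂ = t₂} p) =
  +-monoʳ-< (norm t) (*-monoʳ-<-positive (hash-positive t) (+-monoˡ-< (norm t₂) (lemma7 p)))
lemma7 (c-case₂ {t = t} {t₁ = t₁} p) =
  +-monoʳ-< (norm t) (*-monoʳ-<-positive (hash-positive t) (+-monoʳ-< (norm t₁) (lemma7 p)))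
lemma7 (c-boxᵢ {ts = ts} {s = s} i p) =
  +-mono-<-≤ (*-monoʳ-<-positive (norm-positive s) (normProd-[]≔-< ts i (lemma7 p)))
             (≤-reflexive (hashProd-[]≔-cong ts i (hash-invariant p)))
lemma7 (c-boxₛ {ts = ts} p) = +-monoˡ-< _ (*-monoˡ-<-positive (normProd-positive ts) (lemma7 p))
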